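{- Let $a,b,C$ be positive integers with $\gcd(a,b)=1$. Then every integer $n > a(b+1)(b+C)$ can be written as $n=ax+by$ with integers $x,y$ satisfying $x \ge C$ and $y > ax$. -}

module Defs where

-- Pick t with a t ≡ n (mod b) by Bézout, and let x be the representative of t modulo b in
-- the window [C, C + b); then y = (n - a x) / b is an integer.  Since x ≤ b + C, the
-- hypothesis gives n > a (b + 1) x, i.e. b y = n - a x > a b x, so y > a x.
module Submission where

open import Defs
open import Data.Nat using (ℕ; NonZero; >-nonZero) renaming (_<_ to _<ℕ_)
import Data.Nat as ℕ
open import Data.Nat.GCD using (gcd; module Bézout)
open import Data.Nat.Coprimality using (coprime-Bézout; gcd≡1⇒coprime)
open import Data.Integer using (ℤ; +_; _+_; _*_; _<_; _≤_; -_; _-_; +<+; NonNegative)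
open import Data.Integer.Properties
open import Algebra.Properties.CommutativeSemigroup *-commutativeSemigroup using (x∙yz≈y∙xz)
open import Data.Integer.DivMod using (_%ℕ_; _/ℕ_; a≡a%ℕn+[a/ℕn]*n; n%ℕd<d)
open import Data.Integer.Tactic.RingSolver using (solve)
open import Data.List using (_∷_; [])
open import Data.Product using (∃₂; _×_; _,_)
open import Relation.Binary.PropositionalEquality using (_≡_; refl; sym; trans; cong; module ≡-Reasoning)

pos-1+*≡* : ∀ {x y m n} → 1 ℕ.+ y ℕ.* n ≡ x ℕ.* m → + 1 + + y * + n ≡ + x * + m
pos-1+*≡* {x} {y} {m} {n} eq =
  trans (sym (cong (_+_ (+ 1)) (pos-* y n))) (trans (cong +_ eq) (pos-* x m))

coprime⇒bézoutℤ : ∀ {a b} → gcd a b ≡ 1 → ∃₂ λ s k → + a * s ≡ + 1 + + b * k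
coprime⇒bézoutℤ {a} {b} g with coprime-Bézout (gcd≡1⇒coprime {a} {b} g)
... | Bézout.+- u v eq = + u , + v , rearrange {+ a} {+ b} (pos-1+*≡* {u} {v} eq)
  where
  rearrange : ∀ {A B U V} → + 1 + V * B ≡ U * A → A * U ≡ + 1 + B * V
  rearrange {A} {B} {U} {V} e = begin
    A * U         ≡⟨ *-comm A U ⟩
    U * A         ≡⟨ sym e ⟩
    + 1 + V * B   ≡⟨ cong (_+_ (+ 1)) (*-comm V B) ⟩
    + 1 + B * V   ∎
    where open ≡-Reasoning
... | Bézout.-+ u v eq = - + u , - + v , rearrange-negated {+ a} {+ b} (pos-1+*≡* {v} {u} eq)
  where
  rearrange-negated : ∀ {A B U V} → + 1 + U * A ≡ V * B → A * (- U) ≡ + 1 + B * (- V)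
  rearrange-negated {A} {B} {U} {V} e = begin
    A * (- U)             ≡⟨ solve (A ∷ U ∷ []) ⟩
    + 1 - (+ 1 + U * A)   ≡⟨ cong (_-_ (+ 1)) e ⟩
    + 1 - V * B           ≡⟨ solve (B ∷ V ∷ []) ⟩
    + 1 + B * (- V)       ∎
    where open ≡-Reasoning

representation-from-inverse : ∀ {A B n s k c r q : ℤ} →
  A * s ≡ + 1 + B * k → n * s - c ≡ r + q * B → n ≡ A * (c + r) + B * (A * q - n * k)
representation-from-inverse {A} {B} {n} {s} {k} {c} {r} {q} As≡1+Bk ns-c≡r+qB = begin
  n                                 ≡⟨ solve (n ∷ B ∷ k ∷ []) ⟩
  n * (+ 1 + B * k) - B * (n * k)   ≡⟨ cong (λ z → n * z - B * (n * k)) (sym As≡1+Bk) ⟩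
  n * (A * s) - B * (n * k)         ≡⟨ solve (A ∷ B ∷ n ∷ s ∷ k ∷ c ∷ []) ⟩
  A * (c + (n * s - c)) - B * (n * k) ≡⟨ cong (λ z → A * (c + z) - B * (n * k)) ns-c≡r+qB ⟩
  A * (c + (r + q * B)) - B * (n * k) ≡⟨ solve (A ∷ B ∷ n ∷ k ∷ c ∷ r ∷ q ∷ []) ⟩
  A * (c + r) + B * (A * q - n * k)  ∎
  where open ≡-Reasoning

representation-in-window : ∀ {a b} .{{_ : NonZero b}} → gcd a b ≡ 1 → ∀ n c →
  ∃₂ λ x y → n ≡ + a * x + + b * y × c ≤ x × x < c + + b
representation-in-window {a} {b} g n c with coprime⇒bézoutℤ {a} {b} g
... | s , k , as≡1+bk =
  c + + r , + a * q - n * k ,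
  representation-from-inverse {+ a} {+ b} {n} {s} {k} {c} as≡1+bk (a≡a%ℕn+[a/ℕn]*n (n * s - c) b) ,
  i≤i+j c (+ r) ,
  +-monoʳ-< c (+<+ (n%ℕd<d (n * s - c) b))
  where
  r = (n * s - c) %ℕ b
  q = (n * s - c) /ℕ b

<-of-dominated-representation : ∀ B .{{_ : NonNegative B}} {u y n} →
  n ≡ u + B * y → (B + + 1) * u < n → u < y
<-of-dominated-representation B {u} {y} {n} n≡u+By [B+1]u<n =
  ≰⇒> λ y≤u → <-irrefl refl (begin-strict
    (B + + 1) * u   <⟨ [B+1]u<n ⟩
    n               ≡⟨ n≡u+By ⟩
    u + B * y       ≤⟨ +-monoʳ-≤ u (*-monoˡ-≤-nonNeg B y≤u) ⟩
    u + B * u       ≡⟨ solve (B ∷ u ∷ []) ⟩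
    (B + + 1) * u   ∎)
  where open ≤-Reasoning

lemma4p3 : (a b C : ℕ) → 0 <ℕ a → 0 <ℕ b → 0 <ℕ C → gcd a b ≡ 1 →
    (n : ℤ) → (+ a) * ((+ b) + + 1) * ((+ b) + (+ C)) < n →
    ∃₂ λ (x y : ℤ) → n ≡ (+ a) * x + (+ b) * y × (+ C) ≤ x × (+ a) * x < y
lemma4p3 a b C _ 0<b _ g n bound =
  let x , y , n≡ax+by , C≤x , x<C+b = representation-in-window {a} {b} {{>-nonZero 0<b}} g n (+ C)
      x≤b+C = ≤-trans (<⇒≤ x<C+b) (≤-reflexive (+-comm (+ C) (+ b)))
      [b+1]ax<n = begin-strict
        (+ b + + 1) * (+ a * x)           ≡⟨ x∙yz≈y∙xz (+ b + + 1) (+ a) x ⟩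
        + a * ((+ b + + 1) * x)           ≤⟨ *-monoˡ-≤-nonNeg (+ a) (*-monoˡ-≤-nonNeg (+ b + + 1) x≤b+C) ⟩
        + a * ((+ b + + 1) * (+ b + + C)) ≡⟨ *-assoc (+ a) (+ b + + 1) (+ b + + C) ⟨
        + a * (+ b + + 1) * (+ b + + C)   <⟨ bound ⟩
        n                                 ∎
  in x , y , n≡ax+by , C≤x , <-of-dominated-representation (+ b) n≡ax+by [b+1]ax<n
  where open ≤-Reasoning
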